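{- Let $M$ be a tame paving matroid of rank $n$ on $[d]$ with set of dependent hyperplanes $\mathcal{L}$, let $\mathcal{Q}=\{Q_1,\ldots,Q_k\}$ be a nice partition of $\mathcal{L}$, and let $\operatorname{rank}$ denote the rank function of $M(\mathcal{Q})$. Then (i) $\operatorname{rank}(l)=n-1$ for every $l\in\mathcal{L}$; and (ii) if $l_1,l_2\in\mathcal{L}$ lie in different parts of $\mathcal{Q}$, then $\operatorname{rank}(l_1\cup l_2)=n$.
   Context: A rank-$n$ matroid is paving if all circuits have size $n$ or $n+1$; dependent hyperplanes are maximal sets of size $\ge n$ all of whose $n$-subsets are circuits; tame means any three distinct dependent hyperplanes have empty intersection. $M(\mathcal{Q})$: with $H_i=\bigcup_{l\in Q_i}l$, the matroid on $[d]$ whose circuits are the $(n-1)$-subsets of some $H_i\cap H_j$, $i\ne j$ (Type 1), the $n$-subsets of some $H_i$ containing no Type 1 set (Type 2), and the $(n+1)$-subsets containing no Type 1 or 2 set (Type 3). For $L\subseteq\mathcal{L}$, $|L|\ge2$, $M^L$ is the rank-$n$ paving matroid on $\bigcup_{l\in L}l$ whose dependent hyperplanes are exactly the members of $L$. For a rank-$n$ matroid $N$ on $E$, $V_{\mathcal{C}(N)}$ is the set of tuples $(\gamma_e)$ in $\mathbb{C}^n$ with $(\gamma_e)_{e\in D}$ dependent for all dependent $D$; $N$ is liftable if for every tuple in $\mathbb{C}^n$ spanning a hyperplane $H$ and every $q\notin H$ there are scalars $z_e$ with $(\gamma_e+z_eq)\in V_{\mathcal{C}(N)}$ spanning $\mathbb{C}^n$.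 $\mathcal{Q}$ is nice if (i) $M^{Q_i}$ is not liftable whenever $|Q_i|\ge2$ and (ii) there is no $i$ and $l\in\mathcal{L}\setminus Q_i$ with $l\subseteq\bigcup_{l'\in Q_i}l'$. -}

module Defs where

open import Level using (Level; _⊔_) renaming (suc to lsuc)
open import Data.Nat using (ℕ; zero; suc; _≤_; _∸_)
open import Data.Fin using (Fin)
open import Data.Fin.Subset as S using (Subset; ⋃; ∣_∣; _∪_; _∩_; _⊆_; ⊥)
import Data.Bool
import Data.Vec
import Data.Fin
open import Data.List using (List; []; _∷_; _++_; [_])
open import Data.List.Membership.Propositional using () renaming (_∈_ to _∈L_)
open import Data.Product using (Σ; ∃; ∃-syntax; _×_; _,_)
open import Data.Sum using (_⊎_)
open import Relation.Nullary using (¬_)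
open import Relation.Binary.PropositionalEquality using (_≡_; _≢_)
open import Algebra.Bundles using (CommutativeRing)

record Matroid (d : ℕ) : Set₁ where
  field
    Indep      : Subset d → Set
    indep-∅    : Indep ⊥
    indep-⊆    : ∀ {I J} → J ⊆ I → Indep I → Indep J
    indep-aug  : ∀ {I J} → Indep I → Indep J → ∣ I ∣ Data.Nat.< ∣ J ∣ →
                 ∃[ x ] (x S.∈ J × ¬ (x S.∈ I) × Indep (I ∪ S.⁅ x ⁆))

module _ {d : ℕ} where

  HasRank : (Subset d → Set) → Subset d → ℕ → Set
  HasRank Ind X r =
    (∃[ I ] (I ⊆ X × Ind I × ∣ I ∣ ≡ r)) ×
    (∀ I → I ⊆ X → Ind I → ∣ I ∣ ≤ r)

module _ {d : ℕ} (M : Matroid d) where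
  open Matroid M

  HasMatroidRank : ℕ → Set
  HasMatroidRank n = HasRank Indep (S.⊤) n

  Circuit : Subset d → Set
  Circuit C = ¬ Indep C × (∀ T → T ⊆ C → T ≢ C → Indep T)

  IsPaving : ℕ → Set
  IsPaving n = HasMatroidRank n × (∀ C → Circuit C → ∣ C ∣ ≡ n ⊎ ∣ C ∣ ≡ suc n)

  AllNSubsetsCircuits : ℕ → Subset d → Set
  AllNSubsetsCircuits n X = ∀ T → T ⊆ X → ∣ T ∣ ≡ n → Circuit T

  IsDepHyp : ℕ → Subset d → Set
  IsDepHyp n X =
    n ≤ ∣ X ∣ × AllNSubsetsCircuits n X ×
    (∀ Y → X ⊆ Y → n ≤ ∣ Y ∣ → AllNSubsetsCircuits n Y → Y ≡ X)

  IsTame : ℕ → Set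
  IsTame n = ∀ X Y Z → IsDepHyp n X → IsDepHyp n Y → IsDepHyp n Z →
             X ≢ Y → Y ≢ Z → X ≢ Z → X ∩ Y ∩ Z ≡ ⊥

module _ {d k : ℕ} (n : ℕ) (Q : Fin k → List (Subset d)) where

  H : Fin k → Subset d
  H i = ⋃ (Q i)

  Type1 : Subset d → Set
  Type1 C = suc ∣ C ∣ ≡ n × ∃[ i ] ∃[ j ] (i ≢ j × C ⊆ (H i ∩ H j))

  Type2 : Subset d → Set
  Type2 C = ∣ C ∣ ≡ n × ∃[ i ] (C ⊆ H i) × (∀ T → T ⊆ C → ¬ Type1 T)

  Type3 : Subset d → Set
  Type3 C = ∣ C ∣ ≡ suc n × (∀ T → T ⊆ C → ¬ Type1 T × ¬ Type2 T)

  CircuitMQ : Subset d → Set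
  CircuitMQ C = Type1 C ⊎ Type2 C ⊎ Type3 C

  IndepMQ : Subset d → Set
  IndepMQ X = ∀ C → C ⊆ X → ¬ CircuitMQ C

  RankMQ : Subset d → ℕ → Set
  RankMQ = HasRank IndepMQ

module _ {c ℓ : Level} (R : CommutativeRing c ℓ) where
  open CommutativeRing R

  -- evaluation of a polynomial given by its coefficient list
  -- (constant coefficient first)
  evalPoly : List Carrier → Carrier → Carrier
  evalPoly []       x = 0#
  evalPoly (a ∷ as) x = a + x * evalPoly as x

  natR : ℕ → Carrier
  natR zero    = 0#
  natR (suc m) = 1# + natR m

record ACF0 (c ℓ : Level) : Set (lsuc (c ⊔ ℓ)) where
  field
    commRing : CommutativeRing c ℓ
  open CommutativeRing commRing public hiding (ring)
  field
    one≉zero   : ¬ (1# ≈ 0#)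
    inverse    : ∀ x → ¬ (x ≈ 0#) → ∃[ y ] (x * y ≈ 1#)
    -- every monic polynomial of degree ≥ 1 has a root
    alg-closed : ∀ (a : Carrier) (as : List Carrier) →
                 ∃[ x ] (evalPoly commRing (a ∷ as ++ [ 1# ]) x ≈ 0#)
    char-zero  : ∀ m → ¬ (natR commRing (suc m) ≈ 0#)

module _ {c ℓ : Level} (K : ACF0 c ℓ) where
  open ACF0 K

  Vecₖ : ℕ → Set c
  Vecₖ n = Fin n → Carrier

  module _ {n : ℕ} where
    0v : Vecₖ n
    0v _ = 0#

    _+v_ : Vecₖ n → Vecₖ n → Vecₖ n
    (u +v v) i = u i + v i

    _·v_ : Carrier → Vecₖ n → Vecₖ n
    (a ·v v) i = a * v i

    _≈v_ : Vecₖ n → Vecₖ n → Set ℓ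
    u ≈v v = ∀ i → u i ≈ v i

  sumOver : ∀ {n d} → Subset d → (Fin d → Vecₖ n) → Vecₖ n
  sumOver {d = zero}  _              f = 0v
  sumOver {d = suc d} (Data.Bool.true  Data.Vec.∷ D) f =
    f Fin.zero +v sumOver D (λ e → f (Fin.suc e))
    where import Data.Fin as Fin
  sumOver {d = suc d} (Data.Bool.false Data.Vec.∷ D) f =
    sumOver D (λ e → f (Data.Fin.suc e))

  LinDep : ∀ {n d} → (Fin d → Vecₖ n) → Subset d → Set (c ⊔ ℓ)
  LinDep {n} {d} γ D = Σ (Fin d → Carrier) λ a → ((∃[ e ] (e S.∈ D × ¬ (a e ≈ 0#))) ×
                       sumOver D (λ e → a e ·v γ e) ≈v 0v)

  Spans : ∀ {n d} → (Fin d → Vecₖ n) → Subset d → Set (c ⊔ ℓ)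
  Spans {n} {d} γ D = ∀ v → Σ (Fin d → Carrier) λ a → (sumOver D (λ e → a e ·v γ e) ≈v v)

  InSpan : ∀ {n d} → (Fin d → Vecₖ n) → Subset d → Vecₖ _ → Set (c ⊔ ℓ)
  InSpan {n} {d} γ D q = Σ (Fin d → Carrier) λ a → (sumOver D (λ e → a e ·v γ e) ≈v q)

  -- the vectors (γ_e)_{e ∈ D} span a hyperplane of K^n, i.e. their span has
  -- dimension n-1: they do not span K^n, but they contain n-1 linearly
  -- independent vectors
  SpansHyperplane : ∀ {n d} → (Fin d → Vecₖ n) → Subset d → Set (c ⊔ ℓ)
  SpansHyperplane {n} γ D =
    ¬ Spans γ D × ∃[ B ] (B ⊆ D × suc ∣ B ∣ ≡ n × ¬ LinDep γ B)

  module _ {d : ℕ} (n : ℕ) (L : List (Subset d)) where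

    groundL : Subset d
    groundL = ⋃ L

    -- dependent sets of M^L, the rank-n paving matroid on ⋃L whose
    -- dependent hyperplanes are exactly the members of L: subsets of the
    -- ground set which have more than n elements or contain n elements of
    -- some member of L
    DependentL : Subset d → Set
    DependentL D = D ⊆ groundL ×
      (suc n ≤ ∣ D ∣ ⊎ ∃[ l ] (l ∈L L × ∃[ T ] (T ⊆ D × T ⊆ l × ∣ T ∣ ≡ n)))

    InV : (Fin d → Vecₖ n) → Set (c ⊔ ℓ)
    InV γ = ∀ D → DependentL D → LinDep γ D

    LiftableL : Set (c ⊔ ℓ)
    LiftableL = ∀ (γ : Fin d → Vecₖ n) (q : Vecₖ n) →
      SpansHyperplane γ groundL → ¬ InSpan γ groundL q →
      Σ (Fin d → Carrier) λ z → (InV (λ e → γ e +v (z e ·v q)) ×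
              Spans (λ e → γ e +v (z e ·v q)) groundL)

module _ {d : ℕ} (M : Matroid d) (n : ℕ) where

  IsPartitionDH : ∀ {k} → (Fin k → List (Subset d)) → Set
  IsPartitionDH {k} Q =
    (∀ i → ∃[ l ] (l ∈L Q i)) ×
    (∀ i l → l ∈L Q i → IsDepHyp M n l) ×
    (∀ l → IsDepHyp M n l → ∃[ i ] (l ∈L Q i)) ×
    (∀ i j l → l ∈L Q i → l ∈L Q j → i ≡ j)

  IsNice : ∀ {c ℓ} → ACF0 c ℓ → ∀ {k} → (Fin k → List (Subset d)) → Set (c ⊔ ℓ)
  IsNice K Q =
    (∀ i → (∃[ l ] ∃[ l' ] (l ∈L Q i × l' ∈L Q i × l ≢ l')) →
       ¬ LiftableL K n (Q i)) ×
    (¬ (∃[ i ] ∃[ l ] (IsDepHyp M n l × ¬ (l ∈L Q i) × l ⊆ ⋃ (Q i))))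

{-# OPTIONS --safe #-}
-- Below size n, the only circuits of M(Q) are the (n-1)-sets lying in two of the H_i. By
-- tameness a point lies in at most two H_i, distinct dependent hyperplanes share no
-- (n-1)-set, and niceness puts a point of each l ∈ Q_a outside H_b for every b ≠ a. These
-- facts give every l an (n-1)-subset inside no two H_i, which is independent; for l₁ ∈ Q_a,
-- adding a point of l₂ outside H_a keeps it independent. The upper bounds hold because the
-- n-subsets of H_a are dependent and so is every (n+1)-set.
module Submission where

open import Defs
open import Data.Bool using () renaming (_≟_ to _≟ᵇ_)
open import Data.Nat using (ℕ; zero; suc; _≤_; _<_; _∸_; z≤n; s≤s; s≤s⁻¹; _≤?_; _<?_; _≟_)
open import Data.Nat.Properties
open import Data.Fin using (Fin) renaming (_≟_ to _≟ᶠ_)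
open import Data.Fin.Properties using (any?)
open import Data.Fin.Subset
  using (Subset; _∪_; _∩_; _⊆_; _⊂_; ⁅_⁆; ∣_∣; ⋃; Nonempty; inside; outside)
  renaming (_∈_ to _∈ₛ_; _∉_ to _∉ₛ_; ⊥ to ∅)
open import Data.Fin.Subset.Properties
open import Data.Fin.Subset.Induction using (Acc; acc; ⊂-wellFounded)
import Data.Vec as Vec
open import Data.Vec.Properties using (≡-dec)
open import Data.List using (List; []; _∷_)
open import Data.List.Membership.Propositional using (_∈_)
open import Data.List.Relation.Unary.Any using (here; there)
open import Data.Product using (∃-syntax; _×_; _,_; proj₁; proj₂)
open import Data.Sum using (inj₁; inj₂; [_,_])
open import Data.Empty using (⊥-elim)
open import Function using (_∘_; id)
open import Relation.Nullary using (¬_; yes; no; ¬?)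
open import Relation.Nullary.Negation using (¬¬-map)
open import Relation.Nullary.Decidable using (decidable-stable; _×-dec_)
open import Relation.Binary.PropositionalEquality
  using (_≡_; _≢_; refl; sym; trans; cong; subst; ≢-sym)

private
  variable
    d n : ℕ
    x y : Fin d
    p q r : Subset d

x∈⋃⁻ : ∀ (ps : List (Subset d)) → x ∈ₛ ⋃ ps → ∃[ p ] (p ∈ ps × x ∈ₛ p)
x∈⋃⁻ []       x∈∅ = ⊥-elim (∉⊥ x∈∅)
x∈⋃⁻ (p ∷ ps) x∈⋃ with x∈p∪q⁻ p (⋃ ps) x∈⋃
... | inj₁ x∈p   = p , here refl , x∈p
... | inj₂ x∈⋃ps = let q , q∈ps , x∈q = x∈⋃⁻ ps x∈⋃ps in q , there q∈ps , x∈q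

p∈ps⇒p⊆⋃ps : ∀ {ps : List (Subset d)} → p ∈ ps → p ⊆ ⋃ ps
p∈ps⇒p⊆⋃ps (here refl)  = p⊆p∪q _
p∈ps⇒p⊆⋃ps (there p∈ps) = ⊆-trans (p∈ps⇒p⊆⋃ps p∈ps) (q⊆p∪q _ _)

p⊆r∧q⊆r⇒p∪q⊆r : p ⊆ r → q ⊆ r → p ∪ q ⊆ r
p⊆r∧q⊆r⇒p∪q⊆r p⊆r q⊆r x∈p∪q = [ p⊆r , q⊆r ] (x∈p∪q⁻ _ _ x∈p∪q)

x∈p⇒⁅x⁆⊆p : x ∈ₛ p → ⁅ x ⁆ ⊆ p
x∈p⇒⁅x⁆⊆p {p = p} x∈p y∈⁅x⁆ = subst (_∈ₛ p) (sym (x∈⁅y⁆⇒x≡y _ y∈⁅x⁆)) x∈p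

x∈p∪⁅y⁆∧x≢y⇒x∈p : x ∈ₛ p ∪ ⁅ y ⁆ → x ≢ y → x ∈ₛ p
x∈p∪⁅y⁆∧x≢y⇒x∈p x∈ x≢y = [ id , ⊥-elim ∘ x≢y ∘ x∈⁅y⁆⇒x≡y _ ] (x∈p∪q⁻ _ _ x∈)

x∉p⇒∣p∪⁅x⁆∣≡1+∣p∣ : x ∉ₛ p → ∣ p ∪ ⁅ x ⁆ ∣ ≡ suc ∣ p ∣
x∉p⇒∣p∪⁅x⁆∣≡1+∣p∣ {x = Fin.zero}  {p = outside Vec.∷ p} _ = cong (suc ∘ ∣_∣) (∪-identityʳ p)
x∉p⇒∣p∪⁅x⁆∣≡1+∣p∣ {x = Fin.zero}  {p = inside Vec.∷ p} x∉p = ⊥-elim (x∉p Vec.here)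
x∉p⇒∣p∪⁅x⁆∣≡1+∣p∣ {x = Fin.suc x} {p = outside Vec.∷ p} x∉p =
  x∉p⇒∣p∪⁅x⁆∣≡1+∣p∣ (drop-not-there x∉p)
x∉p⇒∣p∪⁅x⁆∣≡1+∣p∣ {x = Fin.suc x} {p = inside Vec.∷ p} x∉p =
  cong suc (x∉p⇒∣p∪⁅x⁆∣≡1+∣p∣ (drop-not-there x∉p))

p⊈q⇒∃∈∉ : ¬ p ⊆ q → ∃[ x ] (x ∈ₛ p × x ∉ₛ q)
p⊈q⇒∃∈∉ {p = p} {q = q} p⊈q with any? (λ x → (x ∈? p) ×-dec ¬? (x ∈? q))
... | yes witness = witness
... | no ∄x = ⊥-elim (p⊈q λ {x} x∈p → decidable-stable (x ∈? q) (λ x∉q → ∄x (x , x∈p , x∉q)))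

∣q∣<∣p∣⇒∃∈∉ : ∣ q ∣ < ∣ p ∣ → ∃[ x ] (x ∈ₛ p × x ∉ₛ q)
∣q∣<∣p∣⇒∃∈∉ ∣q∣<∣p∣ = p⊈q⇒∃∈∉ (<⇒≱ ∣q∣<∣p∣ ∘ p⊆q⇒∣p∣≤∣q∣)

0<∣p∣⇒Nonempty : ∀ {d} {p : Subset d} → 0 < ∣ p ∣ → Nonempty p
0<∣p∣⇒Nonempty {d} {p} 0<∣p∣ =
  let x , x∈p , _ = ∣q∣<∣p∣⇒∃∈∉ {q = ∅} (subst (_< ∣ p ∣) (sym (∣⊥∣≡0 d)) 0<∣p∣) in x , x∈p

x∈p⇒0<∣p∣ : x ∈ₛ p → 0 < ∣ p ∣
x∈p⇒0<∣p∣ {x = x} x∈p = subst (_≤ _) (∣⁅x⁆∣≡1 x) (p⊆q⇒∣p∣≤∣q∣ (x∈p⇒⁅x⁆⊆p x∈p))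

1<∣p∣⇒∃≢ : 1 < ∣ p ∣ → ∃[ x ] (x ∈ₛ p × x ≢ y)
1<∣p∣⇒∃≢ {y = y} 1<∣p∣ =
  let x , x∈p , x∉⁅y⁆ = ∣q∣<∣p∣⇒∃∈∉ (subst (_< _) (sym (∣⁅x⁆∣≡1 y)) 1<∣p∣)
  in x , x∈p , x∉⁅y⁆⇒x≢y x∉⁅y⁆

p⊆q∧∣q∣≤∣p∣⇒q⊆p : p ⊆ q → ∣ q ∣ ≤ ∣ p ∣ → q ⊆ p
p⊆q∧∣q∣≤∣p∣⇒q⊆p p⊆q ∣q∣≤∣p∣ = decidable-stable (_ ⊆? _) λ q⊈p →
  <⇒≱ (p⊂q⇒∣p∣<∣q∣ (p⊆q , p⊈q⇒∃∈∉ q⊈p)) ∣q∣≤∣p∣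

p⊆q∧p≢q⇒p⊂q : p ⊆ q → p ≢ q → p ⊂ q
p⊆q∧p≢q⇒p⊂q p⊆q p≢q = p⊆q , p⊈q⇒∃∈∉ (p≢q ∘ ⊆-antisym p⊆q)

⊆-extend : p ⊆ q → ∣ p ∣ ≤ n → n ≤ ∣ q ∣ → ∃[ r ] (p ⊆ r × r ⊆ q × ∣ r ∣ ≡ n)
⊆-extend {n = zero} p⊆q ∣p∣≤0 _ = _ , ⊆-refl , p⊆q , n≤0⇒n≡0 ∣p∣≤0
⊆-extend {p = p} {q = q} {n = suc n} p⊆q ∣p∣≤1+n 1+n≤∣q∣ with ∣ p ∣ ≤? n
... | no ∣p∣≰n = p , ⊆-refl , p⊆q , ≤-antisym ∣p∣≤1+n (≰⇒> ∣p∣≰n)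
... | yes ∣p∣≤n with ⊆-extend p⊆q ∣p∣≤n (<⇒≤ 1+n≤∣q∣)
... | r , p⊆r , r⊆q , ∣r∣≡n with ∣q∣<∣p∣⇒∃∈∉ {q = r} (subst (_< ∣ q ∣) (sym ∣r∣≡n) 1+n≤∣q∣)
... | x , x∈q , x∉r =
  r ∪ ⁅ x ⁆ , ⊆-trans p⊆r (p⊆p∪q _) , p⊆r∧q⊆r⇒p∪q⊆r r⊆q (x∈p⇒⁅x⁆⊆p x∈q) ,
  trans (x∉p⇒∣p∪⁅x⁆∣≡1+∣p∣ x∉r) (cong suc ∣r∣≡n)

∃⊆∧∣∣≡ : ∀ {d} {q : Subset d} → n ≤ ∣ q ∣ → ∃[ r ] (r ⊆ q × ∣ r ∣ ≡ n)
∃⊆∧∣∣≡ {d = d} n≤∣q∣ =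
  let r , _ , r⊆q , ∣r∣≡n = ⊆-extend ⊥⊆ (subst (_≤ _) (sym (∣⊥∣≡0 d)) z≤n) n≤∣q∣
  in r , r⊆q , ∣r∣≡n

⊆-extend-below : p ⊆ q → ∣ p ∣ < n → n ≤ ∣ q ∣ → ∃[ r ] (p ⊆ r × r ⊆ q × suc ∣ r ∣ ≡ n)
⊆-extend-below {n = suc n} p⊆q (s≤s ∣p∣≤n) 1+n≤∣q∣ =
  let r , p⊆r , r⊆q , ∣r∣≡n = ⊆-extend p⊆q ∣p∣≤n (<⇒≤ 1+n≤∣q∣)
  in r , p⊆r , r⊆q , cong suc ∣r∣≡n

¬¬-→ : ∀ {A B : Set} → (A → ¬ ¬ B) → ¬ ¬ (A → B)
¬¬-→ f ¬[A→B] = ¬[A→B] (λ a → ⊥-elim (f a (λ b → ¬[A→B] (λ _ → b))))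

¬¬-∀-Subset : ∀ {P : Subset d → Set} → (∀ p → ¬ ¬ P p) → ¬ ¬ (∀ p → P p)
¬¬-∀-Subset {d = zero}  f ¬∀ = f Vec.[] (λ P[] → ¬∀ λ { Vec.[] → P[] })
¬¬-∀-Subset {d = suc d} f ¬∀ =
  ¬¬-∀-Subset (f ∘ (inside Vec.∷_)) λ ∀inside →
  ¬¬-∀-Subset (f ∘ (outside Vec.∷_)) λ ∀outside →
  ¬∀ λ { (inside Vec.∷ p) → ∀inside p ; (outside Vec.∷ p) → ∀outside p }

¬¬-∀-proper : ∀ {P : Subset d → Set} →
  (∀ r → r ⊆ q → r ≢ q → ¬ ¬ P r) → ¬ ¬ (∀ r → r ⊆ q → r ≢ q → P r)
¬¬-∀-proper f = ¬¬-∀-Subset λ r → ¬¬-→ {A = r ⊆ _} λ r⊆q → ¬¬-→ (f r r⊆q)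

depHyp⇒1≤n : (M : Matroid d) → IsDepHyp M n p → 1 ≤ n
depHyp⇒1≤n {d} {n = zero} M (_ , circuits , _) =
  ⊥-elim (proj₁ (circuits ∅ ⊥⊆ (∣⊥∣≡0 d)) (Matroid.indep-∅ M))
depHyp⇒1≤n {n = suc n} _ _ = s≤s z≤n

module PavingMatroid {d : ℕ} (M : Matroid d) {n : ℕ} (paving : IsPaving M n) where
  open Matroid M

  n≤∣circuit∣ : Circuit M p → n ≤ ∣ p ∣
  n≤∣circuit∣ circuit =
    [ ≤-reflexive ∘ sym , <⇒≤ ∘ ≤-reflexive ∘ sym ] (proj₂ paving _ circuit)

  -- Indep is an arbitrary predicate, so "a dependent set contains a circuit" only holds
  -- under double negation; depHyps-sharing-facet-≡ discharges it through decidable equality.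
  ¬¬-indep-below-n : ∣ p ∣ < n → ¬ ¬ Indep p
  ¬¬-indep-below-n = go (⊂-wellFounded _)
    where
    go : Acc _⊂_ p → ∣ p ∣ < n → ¬ ¬ Indep p
    go (acc smaller) ∣p∣<n ¬indep =
      ¬¬-∀-proper
        (λ q q⊆p q≢p → let q⊂p = p⊆q∧p≢q⇒p⊂q q⊆p q≢p in
                       go (smaller q⊂p) (<-trans (p⊂q⇒∣p∣<∣q∣ q⊂p) ∣p∣<n))
        (λ proper → <⇒≱ ∣p∣<n (n≤∣circuit∣ (¬indep , proper)))

  depHyp-indep-below-n : IsDepHyp M n p → q ⊆ p → ∣ q ∣ < n → Indep q
  depHyp-indep-below-n (n≤∣p∣ , circuits , _) q⊆p ∣q∣<n =
    let r , q⊆r , r⊆p , ∣r∣≡n = ⊆-extend q⊆p (<⇒≤ ∣q∣<n) n≤∣p∣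
    in proj₂ (circuits r r⊆p ∣r∣≡n) _ q⊆r (λ q≡r → <-irrefl (trans (cong ∣_∣ q≡r) ∣r∣≡n) ∣q∣<n)

  depHyp-facet∪point-dependent :
    IsDepHyp M n p → q ⊆ p → suc ∣ q ∣ ≡ n → x ∈ₛ p → x ∉ₛ q → ¬ Indep (q ∪ ⁅ x ⁆)
  depHyp-facet∪point-dependent (_ , circuits , _) q⊆p ∣q∣ x∈p x∉q =
    proj₁ (circuits _ (p⊆r∧q⊆r⇒p∪q⊆r q⊆p (x∈p⇒⁅x⁆⊆p x∈p)) (trans (x∉p⇒∣p∪⁅x⁆∣≡1+∣p∣ x∉q) ∣q∣))

  depHyp-maximal : IsDepHyp M n p → p ⊆ q → AllNSubsetsCircuits M n q → q ≡ p
  depHyp-maximal (n≤∣p∣ , _ , maximal) p⊆q = maximal _ p⊆q (≤-trans n≤∣p∣ (p⊆q⇒∣p∣≤∣q∣ p⊆q))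

  depHyps-sharing-facet-≡ :
    IsDepHyp M n p → IsDepHyp M n q → r ⊆ p → r ⊆ q → suc ∣ r ∣ ≡ n → p ≡ q
  depHyps-sharing-facet-≡ {p} {q} {r} hp hq r⊆p r⊆q ∣r∣ =
    decidable-stable (≡-dec _≟ᵇ_ p q) (¬¬-map p≡q ¬¬-circuits)
    where
    p≡q : AllNSubsetsCircuits M n (p ∪ q) → p ≡ q
    p≡q circuits = trans (sym (depHyp-maximal hp (p⊆p∪q q) circuits))
                         (depHyp-maximal hq (q⊆p∪q p q) circuits)

    ¬indep : ∀ {t} → t ⊆ p ∪ q → ∣ t ∣ ≡ n → ¬ Indep t
    ¬indep t⊆p∪q ∣t∣ t-indep
      with indep-aug (depHyp-indep-below-n hp r⊆p (≤-reflexive ∣r∣)) t-indep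
                     (≤-reflexive (trans ∣r∣ (sym ∣t∣)))
    ... | x , x∈t , x∉r , r∪x-indep =
      [ (λ x∈p → depHyp-facet∪point-dependent hp r⊆p ∣r∣ x∈p x∉r r∪x-indep)
      , (λ x∈q → depHyp-facet∪point-dependent hq r⊆q ∣r∣ x∈q x∉r r∪x-indep)
      ] (x∈p∪q⁻ p q (t⊆p∪q x∈t))

    ¬¬-circuits : ¬ ¬ AllNSubsetsCircuits M n (p ∪ q)
    ¬¬-circuits = ¬¬-∀-Subset λ t → ¬¬-→ {A = t ⊆ p ∪ q} λ t⊆p∪q → ¬¬-→ λ ∣t∣ →
      ¬¬-map (¬indep t⊆p∪q ∣t∣ ,_) (¬¬-∀-proper λ s s⊆t s≢t →
        ¬¬-indep-below-n (subst (∣ s ∣ <_) ∣t∣ (p⊂q⇒∣p∣<∣q∣ (p⊆q∧p≢q⇒p⊂q s⊆t s≢t))))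

module MQ {d k : ℕ} (n : ℕ) (Q : Fin k → List (Subset d)) where

  CoveredTwice : Subset d → Set
  CoveredTwice p = ∃[ i ] ∃[ j ] (i ≢ j × p ⊆ H n Q i ∩ H n Q j)

  UncoveredFacet : Subset d → Set
  UncoveredFacet l = ∃[ p ] (p ⊆ l × suc ∣ p ∣ ≡ n × ¬ CoveredTwice p)

  coveredTwice-⊆ : p ⊆ q → CoveredTwice q → CoveredTwice p
  coveredTwice-⊆ p⊆q (i , j , i≢j , q⊆) = i , j , i≢j , ⊆-trans p⊆q q⊆

  ¬coveredTwice-through-single-H : ∀ {a} →
    (∀ i → x ∈ₛ H n Q i → i ≡ a) → x ∈ₛ p → ¬ CoveredTwice p
  ¬coveredTwice-through-single-H only-a x∈p (i , j , i≢j , p⊆) =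
    let x∈Hi , x∈Hj = x∈p∩q⁻ _ _ (p⊆ x∈p)
    in i≢j (trans (only-a i x∈Hi) (sym (only-a j x∈Hj)))

  IndepMQ-⊆ : p ⊆ q → IndepMQ n Q q → IndepMQ n Q p
  IndepMQ-⊆ p⊆q indep r r⊆p = indep r (⊆-trans r⊆p p⊆q)

  IndepMQ⇒∣∣≤n : IndepMQ n Q p → ∣ p ∣ ≤ n
  IndepMQ⇒∣∣≤n indep = ≮⇒≥ λ n<∣p∣ →
    let r , r⊆p , ∣r∣ = ∃⊆∧∣∣≡ n<∣p∣
        indep-r = IndepMQ-⊆ r⊆p indep
    in indep-r r ⊆-refl (inj₂ (inj₂ (∣r∣ , λ s s⊆r →
         indep-r s s⊆r ∘ inj₁ , indep-r s s⊆r ∘ inj₂ ∘ inj₁)))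

  IndepMQ∧⊆H⇒∣∣<n : ∀ {i} → p ⊆ H n Q i → IndepMQ n Q p → ∣ p ∣ < n
  IndepMQ∧⊆H⇒∣∣<n {i = i} p⊆Hi indep = ≰⇒> λ n≤∣p∣ →
    let r , r⊆p , ∣r∣ = ∃⊆∧∣∣≡ n≤∣p∣
        indep-r = IndepMQ-⊆ r⊆p indep
    in indep-r r ⊆-refl (inj₂ (inj₁ (∣r∣ , i , ⊆-trans r⊆p p⊆Hi , λ s s⊆r →
         indep-r s s⊆r ∘ inj₁)))

  uncovered-facet-indep : suc ∣ p ∣ ≡ n → ¬ CoveredTwice p → IndepMQ n Q p
  uncovered-facet-indep ∣p∣ uncovered q q⊆p (inj₁ (∣q∣ , covered)) =
    uncovered (coveredTwice-⊆ (p⊆q∧∣q∣≤∣p∣⇒q⊆p q⊆p ∣p∣≤∣q∣) covered)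
    where
    ∣p∣≤∣q∣ = ≤-reflexive (suc-injective (trans ∣p∣ (sym ∣q∣)))
  uncovered-facet-indep ∣p∣ _ q q⊆p (inj₂ (inj₁ (∣q∣ , _))) =
    <-irrefl ∣q∣ (≤-<-trans (p⊆q⇒∣p∣≤∣q∣ q⊆p) (≤-reflexive ∣p∣))
  uncovered-facet-indep ∣p∣ _ q q⊆p (inj₂ (inj₂ (∣q∣ , _))) =
    <-irrefl ∣q∣ (≤-<-trans (p⊆q⇒∣p∣≤∣q∣ q⊆p) (<-trans (≤-reflexive ∣p∣) (n<1+n n)))

  indepMQ-of-size-n :
    ∣ p ∣ ≡ n → (∀ q → q ⊆ p → ¬ Type1 n Q q) → (∀ i → ¬ p ⊆ H n Q i) → IndepMQ n Q p
  indepMQ-of-size-n _ no-type1 _ q q⊆p (inj₁ type1) = no-type1 q q⊆p type1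
  indepMQ-of-size-n ∣p∣ _ not-in-H q q⊆p (inj₂ (inj₁ (∣q∣ , i , q⊆Hi , _))) =
    not-in-H i (⊆-trans (p⊆q∧∣q∣≤∣p∣⇒q⊆p q⊆p (≤-reflexive (trans ∣p∣ (sym ∣q∣)))) q⊆Hi)
  indepMQ-of-size-n ∣p∣ _ _ q q⊆p (inj₂ (inj₂ (∣q∣ , _))) =
    <-irrefl ∣q∣ (s≤s (≤-trans (p⊆q⇒∣p∣≤∣q∣ q⊆p) (≤-reflexive ∣p∣)))

module TamePartition {d k : ℕ} (M : Matroid d) {n : ℕ}
  (paving : IsPaving M n) (tame : IsTame M n)
  (Q : Fin k → List (Subset d)) (partition : IsPartitionDH M n Q)
  (no-stray : ¬ (∃[ i ] ∃[ l ] (IsDepHyp M n l × ¬ (l ∈ Q i) × l ⊆ ⋃ (Q i))))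
  where
  open PavingMatroid M paving
  open MQ n Q

  private
    variable
      a b c : Fin k
      l l′ : Subset d

  ∈Q⇒depHyp : l ∈ Q a → IsDepHyp M n l
  ∈Q⇒depHyp = proj₁ (proj₂ partition) _ _

  depHyp⇒∈Q : IsDepHyp M n l → ∃[ a ] (l ∈ Q a)
  depHyp⇒∈Q = proj₁ (proj₂ (proj₂ partition)) _

  ∈Q-unique : l ∈ Q a → l ∈ Q b → a ≡ b
  ∈Q-unique = proj₂ (proj₂ (proj₂ partition)) _ _ _

  ∈Q⇒⊆H : l ∈ Q a → l ⊆ H n Q a
  ∈Q⇒⊆H = p∈ps⇒p⊆⋃ps

  ∃∈Q-through : x ∈ₛ H n Q a → ∃[ l ] (l ∈ Q a × x ∈ₛ l)
  ∃∈Q-through = x∈⋃⁻ (Q _)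

  ∃∉H-of-other-part : l ∈ Q a → a ≢ b → ∃[ y ] (y ∈ₛ l × y ∉ₛ H n Q b)
  ∃∉H-of-other-part {b = b} l∈Qa a≢b = p⊈q⇒∃∈∉ λ l⊆Hb →
    no-stray (b , _ , ∈Q⇒depHyp l∈Qa , (λ l∈Qb → a≢b (∈Q-unique l∈Qa l∈Qb)) , l⊆Hb)

  shared-facet⇒same-part :
    l ∈ Q a → l′ ∈ Q b → p ⊆ l → p ⊆ l′ → suc ∣ p ∣ ≡ n → a ≡ b
  shared-facet⇒same-part l∈Qa l′∈Qb p⊆l p⊆l′ ∣p∣
    with depHyps-sharing-facet-≡ (∈Q⇒depHyp l∈Qa) (∈Q⇒depHyp l′∈Qb) p⊆l p⊆l′ ∣p∣
  ... | refl = ∈Q-unique l∈Qa l′∈Qb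

  n≡1⇒single-part : n ≡ 1 → (a b : Fin k) → a ≡ b
  n≡1⇒single-part n≡1 a b =
    let l , l∈Qa = proj₁ partition a
        l′ , l′∈Qb = proj₁ partition b
    in shared-facet⇒same-part l∈Qa l′∈Qb ⊥⊆ ⊥⊆ (trans (cong suc (∣⊥∣≡0 d)) (sym n≡1))

  n≡2⇒H-disjoint : n ≡ 2 → x ∈ₛ H n Q a → x ∈ₛ H n Q b → a ≡ b
  n≡2⇒H-disjoint {x = x} n≡2 x∈Ha x∈Hb =
    let l , l∈Qa , x∈l = ∃∈Q-through x∈Ha
        l′ , l′∈Qb , x∈l′ = ∃∈Q-through x∈Hb
    in shared-facet⇒same-part l∈Qa l′∈Qb (x∈p⇒⁅x⁆⊆p x∈l) (x∈p⇒⁅x⁆⊆p x∈l′)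
         (trans (cong suc (∣⁅x⁆∣≡1 x)) (sym n≡2))

  different-parts⇒≢ : l ∈ Q a → l′ ∈ Q b → a ≢ b → l ≢ l′
  different-parts⇒≢ l∈Qa l∈Qb a≢b refl = a≢b (∈Q-unique l∈Qa l∈Qb)

  H-tame : x ∈ₛ H n Q a → x ∈ₛ H n Q b → x ∈ₛ H n Q c → a ≢ b → a ≢ c → b ≡ c
  H-tame {x = x} x∈Ha x∈Hb x∈Hc a≢b a≢c = decidable-stable (_ ≟ᶠ _) λ b≢c →
    let l , l∈Qa , x∈l = ∃∈Q-through x∈Ha
        l′ , l′∈Qb , x∈l′ = ∃∈Q-through x∈Hb
        l″ , l″∈Qc , x∈l″ = ∃∈Q-through x∈Hc
    in ∉⊥ (subst (x ∈ₛ_)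
             (tame l l′ l″ (∈Q⇒depHyp l∈Qa) (∈Q⇒depHyp l′∈Qb) (∈Q⇒depHyp l″∈Qc)
                   (different-parts⇒≢ l∈Qa l′∈Qb a≢b) (different-parts⇒≢ l′∈Qb l″∈Qc b≢c)
                   (different-parts⇒≢ l∈Qa l″∈Qc a≢c))
             (x∈p∩q⁺ (x∈l , x∈p∩q⁺ (x∈l′ , x∈l″))))

  ¬coveredTwice-straddling :
    x ∈ₛ p → y ∈ₛ p → x ∈ₛ H n Q a → y ∉ₛ H n Q a → ¬ CoveredTwice p
  ¬coveredTwice-straddling {y = y} {a = a} x∈p y∈p x∈Ha y∉Ha (i , j , i≢j , p⊆) =
    let x∈Hi , x∈Hj = x∈p∩q⁻ _ _ (p⊆ x∈p)
        y∈Hi , y∈Hj = x∈p∩q⁻ _ _ (p⊆ y∈p)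
    in i≢j (H-tame x∈Ha x∈Hi x∈Hj (a≢ y∈Hi) (a≢ y∈Hj))
    where
    a≢ : ∀ {i} → y ∈ₛ H n Q i → a ≢ i
    a≢ y∈Hi refl = y∉Ha y∈Hi

  facet-through : l ∈ Q a → p ⊆ l → ∣ p ∣ < n → ∃[ q ] (p ⊆ q × q ⊆ l × suc ∣ q ∣ ≡ n)
  facet-through l∈Qa p⊆l ∣p∣<n = ⊆-extend-below p⊆l ∣p∣<n (proj₁ (∈Q⇒depHyp l∈Qa))

  uncovered-facet-through-private-point :
    l ∈ Q a → x ∈ₛ l → 1 < n → (∀ i → x ∈ₛ H n Q i → i ≡ a) → UncoveredFacet l
  uncovered-facet-through-private-point {x = x} l∈Qa x∈l 1<n only-a =
    let p , ⁅x⁆⊆p , p⊆l , ∣p∣ =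
          facet-through l∈Qa (x∈p⇒⁅x⁆⊆p x∈l) (subst (_< n) (sym (∣⁅x⁆∣≡1 x)) 1<n)
    in p , p⊆l , ∣p∣ , ¬coveredTwice-through-single-H only-a (⁅x⁆⊆p (x∈⁅x⁆ x))

  uncovered-facet-through-shared-point :
    l ∈ Q a → x ∈ₛ l → x ∈ₛ H n Q b → a ≢ b → 1 < n → UncoveredFacet l
  uncovered-facet-through-shared-point {x = x} {b = b} l∈Qa x∈l x∈Hb a≢b 1<n
    with ∃∉H-of-other-part l∈Qa a≢b
  ... | y , y∈l , y∉Hb with facet-through l∈Qa ⁅x,y⁆⊆l ∣⁅x,y⁆∣<n
    where
    y∉⁅x⁆ : y ∉ₛ ⁅ x ⁆
    y∉⁅x⁆ y∈⁅x⁆ = y∉Hb (subst (_∈ₛ H n Q b) (sym (x∈⁅y⁆⇒x≡y x y∈⁅x⁆)) x∈Hb)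
    ⁅x,y⁆⊆l : ⁅ x ⁆ ∪ ⁅ y ⁆ ⊆ _
    ⁅x,y⁆⊆l = p⊆r∧q⊆r⇒p∪q⊆r (x∈p⇒⁅x⁆⊆p x∈l) (x∈p⇒⁅x⁆⊆p y∈l)
    n≢2 : n ≢ 2
    n≢2 n≡2 = a≢b (n≡2⇒H-disjoint n≡2 (∈Q⇒⊆H l∈Qa x∈l) x∈Hb)
    ∣⁅x,y⁆∣<n : ∣ ⁅ x ⁆ ∪ ⁅ y ⁆ ∣ < n
    ∣⁅x,y⁆∣<n = subst (_< n) (sym (trans (x∉p⇒∣p∪⁅x⁆∣≡1+∣p∣ y∉⁅x⁆) (cong suc (∣⁅x⁆∣≡1 x))))
                (≤∧≢⇒< 1<n (≢-sym n≢2))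
  ... | p , ⁅x,y⁆⊆p , p⊆l , ∣p∣ =
    p , p⊆l , ∣p∣ ,
    ¬coveredTwice-straddling (⁅x,y⁆⊆p (x∈p∪q⁺ (inj₁ (x∈⁅x⁆ x))))
                             (⁅x,y⁆⊆p (x∈p∪q⁺ (inj₂ (x∈⁅x⁆ y)))) x∈Hb y∉Hb

  uncovered-facet-of-rank≥2 : l ∈ Q a → 1 < n → UncoveredFacet l
  uncovered-facet-of-rank≥2 {a = a} l∈Qa 1<n
    with 0<∣p∣⇒Nonempty (≤-trans (<⇒≤ 1<n) (proj₁ (∈Q⇒depHyp l∈Qa)))
  ... | x , x∈l with any? (λ b → ¬? (a ≟ᶠ b) ×-dec (x ∈? H n Q b))
  ... | yes (b , a≢b , x∈Hb) = uncovered-facet-through-shared-point l∈Qa x∈l x∈Hb a≢b 1<n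
  ... | no ∄b = uncovered-facet-through-private-point l∈Qa x∈l 1<n λ b x∈Hb →
    sym (decidable-stable (a ≟ᶠ b) λ a≢b → ∄b (b , a≢b , x∈Hb))

  ∃-uncovered-facet : l ∈ Q a → UncoveredFacet l
  ∃-uncovered-facet l∈Qa with n ≟ 1
  ... | yes n≡1 = ∅ , ⊥⊆ , trans (cong suc (∣⊥∣≡0 d)) (sym n≡1) ,
                  λ (i , j , i≢j , _) → i≢j (n≡1⇒single-part n≡1 i j)
  ... | no n≢1 = uncovered-facet-of-rank≥2 l∈Qa
                   (≤∧≢⇒< (depHyp⇒1≤n M (∈Q⇒depHyp l∈Qa)) (≢-sym n≢1))

  uncovered-facet∪point-indep : p ⊆ H n Q a → suc ∣ p ∣ ≡ n → ¬ CoveredTwice p →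
    y ∉ₛ H n Q a → IndepMQ n Q (p ∪ ⁅ y ⁆)
  uncovered-facet∪point-indep {p = p} {a = a} {y = y} p⊆Ha ∣p∣ uncovered y∉Ha =
    indepMQ-of-size-n (trans (x∉p⇒∣p∪⁅x⁆∣≡1+∣p∣ (y∉Ha ∘ p⊆Ha)) ∣p∣) no-type1 not-in-H
    where
    not-in-H : ∀ i → ¬ p ∪ ⁅ y ⁆ ⊆ H n Q i
    not-in-H i p∪y⊆Hi with a ≟ᶠ i
    ... | yes refl = y∉Ha (p∪y⊆Hi (x∈p∪q⁺ (inj₂ (x∈⁅x⁆ y))))
    ... | no a≢i =
      uncovered (a , i , a≢i , λ x∈p → x∈p∩q⁺ (p⊆Ha x∈p , p∪y⊆Hi (x∈p∪q⁺ (inj₁ x∈p))))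

    no-type1 : ∀ q → q ⊆ p ∪ ⁅ y ⁆ → ¬ Type1 n Q q
    no-type1 q q⊆p∪y (∣q∣ , covered) with y ∈? q
    ... | no y∉q = uncovered (coveredTwice-⊆ p⊆q covered)
      where
      p⊆q : p ⊆ q
      p⊆q = p⊆q∧∣q∣≤∣p∣⇒q⊆p (λ z∈q → x∈p∪⁅y⁆∧x≢y⇒x∈p (q⊆p∪y z∈q) λ { refl → y∉q z∈q })
                            (≤-reflexive (suc-injective (trans ∣p∣ (sym ∣q∣))))
    ... | yes y∈q with 1 <? ∣ q ∣
    ...   | yes 1<∣q∣ =
      let z , z∈q , z≢y = 1<∣p∣⇒∃≢ 1<∣q∣
          z∈Ha = p⊆Ha (x∈p∪⁅y⁆∧x≢y⇒x∈p (q⊆p∪y z∈q) z≢y)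
      in ¬coveredTwice-straddling z∈q y∈q z∈Ha y∉Ha covered
    ...   | no 1≮∣q∣ =
      let i , j , i≢j , q⊆ = covered
          y∈Hi , y∈Hj = x∈p∩q⁻ _ _ (q⊆ y∈q)
      in i≢j (n≡2⇒H-disjoint n≡2 y∈Hi y∈Hj)
      where
      n≡2 : n ≡ 2
      n≡2 = trans (sym ∣q∣) (cong suc (≤-antisym (s≤s⁻¹ (≰⇒> 1≮∣q∣)) (x∈p⇒0<∣p∣ y∈q)))

  rank-depHyp : IsDepHyp M n l → RankMQ n Q l (n ∸ 1)
  rank-depHyp hl with depHyp⇒∈Q hl
  ... | a , l∈Qa =
    let p , p⊆l , ∣p∣ , uncovered = ∃-uncovered-facet l∈Qa
    in (p , p⊆l , uncovered-facet-indep ∣p∣ uncovered , cong (_∸ 1) ∣p∣) ,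
       λ q q⊆l indep → ∸-monoˡ-≤ 1 (IndepMQ∧⊆H⇒∣∣<n (⊆-trans q⊆l (∈Q⇒⊆H l∈Qa)) indep)

  rank-∪-different-parts : a ≢ b → l ∈ Q a → l′ ∈ Q b → RankMQ n Q (l ∪ l′) n
  rank-∪-different-parts a≢b l∈Qa l′∈Qb =
    let p , p⊆l , ∣p∣ , uncovered = ∃-uncovered-facet l∈Qa
        y , y∈l′ , y∉Ha = ∃∉H-of-other-part l′∈Qb (≢-sym a≢b)
        p⊆Ha = ⊆-trans p⊆l (∈Q⇒⊆H l∈Qa)
    in (p ∪ ⁅ y ⁆ ,
        p⊆r∧q⊆r⇒p∪q⊆r (⊆-trans p⊆l (p⊆p∪q _)) (⊆-trans (x∈p⇒⁅x⁆⊆p y∈l′) (q⊆p∪q _ _)) ,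
        uncovered-facet∪point-indep p⊆Ha ∣p∣ uncovered y∉Ha ,
        trans (x∉p⇒∣p∪⁅x⁆∣≡1+∣p∣ (y∉Ha ∘ p⊆Ha)) ∣p∣) ,
       λ q _ → IndepMQ⇒∣∣≤n

lemma8p2 : ∀ {c ℓ} (K : ACF0 c ℓ) {d n k : ℕ} (M : Matroid d) →
    IsPaving M n → IsTame M n →
    (Q : Fin k → List (Subset d)) → IsPartitionDH M n Q → IsNice M n K Q →
    (∀ l → IsDepHyp M n l → RankMQ n Q l (n ∸ 1)) ×
    (∀ i j l₁ l₂ → i ≢ j → l₁ ∈ Q i → l₂ ∈ Q j → RankMQ n Q (l₁ ∪ l₂) n)
lemma8p2 _ M paving tame Q partition nice =
  (λ _ → rank-depHyp) , (λ _ _ _ _ → rank-∪-different-parts)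
  where
  open TamePartition M paving tame Q partition (proj₂ nice)
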